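{- Let $s(n)$ denote the minimum number such that every temporal clique with $n$ vertices admits a spanner with at most $s(n)$ edges, and let $b(n)$ denote the minimum number such that every temporal bi-clique with $n$ vertices on each side admits a bi-spanner with at most $b(n)$ edges. Then $s(n) \in \Theta(b(n))$.
   Context: A temporal graph is $G=(V,E,\lambda)$ with $(V,E)$ an undirected graph and $\lambda\colon E\to\mathbb{N}$ a labeling (edge $e$ is present at time $\lambda(e)$). A path $v_1v_2\dots v_k$ in $(V,E)$ is a temporal path if $\lambda(\{v_i,v_{i+1}\})\le\lambda(\{v_{i+1},v_{i+2}\})$ for all $i\in[k-2]$ (non-strict). A vertex $u$ reaches $v$ if there is a temporal path from $u$ to $v$; $G$ is temporally connected if every vertex reaches every other vertex. A spanner of $G$ is a set $S\subseteq E$ such that $(V,S,\lambda|_S)$ is temporally connected. A temporal clique is a temporal graph whose underlying graph is complete. A temporal bi-clique $D=(A,B,\lambda)$ is a temporal graph whose underlying graph is the complete bipartite graph with disjoint parts $A,B$ (edge set $\{\{a,b\}: a\in A, b\in B\}$). A bi-spanner of $D$ is a set $S$ of edges of $D$ such that every $a\in A$ can reach every $b\in B$ via a temporal path using only edges of $S$. -}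

module Defs where

open import Data.Nat using (ℕ; zero; suc; _≤_; _*_)
open import Data.Fin using (Fin)
open import Data.List using (List; []; _∷_; length)
open import Data.List.Relation.Unary.All using (All)
open import Data.List.Relation.Unary.Unique.Propositional using (Unique)
open import Data.List.Membership.Propositional using (_∈_)
open import Data.Product using (Σ; _×_; _,_; ∃; ∃-syntax)
open import Data.Empty using (⊥)
open import Data.Sum using (_⊎_; inj₁; inj₂)
open import Relation.Binary.PropositionalEquality using (_≡_; _≢_)

-- A 'Journey t x y' is a walk from x to y whose edge labels are
-- non-decreasing and all at least t (non-strict temporal walk).
data Journey {V : Set} (E : V → V → Set) (ℓ : V → V → ℕ) : ℕ → V → V → Set where
  here : ∀ {t x} → Journey E ℓ t x x
  step : ∀ {t x y z} → E x y → t ≤ ℓ x y → Journey E ℓ (ℓ x y) y z → Journey E ℓ t x z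

verts : ∀ {V E ℓ t x y} → Journey {V} E ℓ t x y → List V
verts {x = x} here = x ∷ []
verts {x = x} (step _ _ j) = x ∷ verts j

Reaches : {V : Set} (E : V → V → Set) (ℓ : V → V → ℕ) → V → V → Set
Reaches E ℓ u v = Σ (Journey E ℓ 0 u v) λ j → Unique (verts j)

-- Temporal cliques on vertex set Fin n.
-- A labelling of the complete graph K_n is a symmetric λ : Fin n → Fin n → ℕ
-- (values on the diagonal are irrelevant: there are no loops).

SymLabel : ℕ → Set
SymLabel n = Σ (Fin n → Fin n → ℕ) λ lab → ∀ u v → lab u v ≡ lab v u

-- A set of edges of K_n, given as a list of pairs (u , v) with u ≢ v,
-- each pair denoting the undirected edge {u , v}.  The number of edges of
-- the set is at most the length of the list.
EdgeIn : ∀ {n} → List (Fin n × Fin n) → Fin n → Fin n → Set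
EdgeIn S x y = ((x , y) ∈ S) ⊎ ((y , x) ∈ S)

IsSpanner : ∀ {n} → (Fin n → Fin n → ℕ) → List (Fin n × Fin n) → Set
IsSpanner {n} lab S =
  All (λ e → Data.Product.proj₁ e ≢ Data.Product.proj₂ e) S ×
  (∀ (u v : Fin n) → u ≢ v → Reaches (EdgeIn S) lab u v)

SpannerBound : ℕ → ℕ → Set
SpannerBound n k = ∀ (L : SymLabel n) →
  ∃[ S ] (IsSpanner (Data.Product.proj₁ L) S × length S ≤ k)

-- Temporal bi-cliques with parts A = Fin n and B = Fin n.
-- Vertex set is Fin n ⊎ Fin n (inj₁ = A, inj₂ = B); the edge {a , b}
-- has label lab a b.  A set of edges is a list of pairs (a , b).

BiEdgeIn : ∀ {n} → List (Fin n × Fin n) → (Fin n ⊎ Fin n) → (Fin n ⊎ Fin n) → Set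
BiEdgeIn S (inj₁ a) (inj₂ b) = (a , b) ∈ S
BiEdgeIn S (inj₂ b) (inj₁ a) = (a , b) ∈ S
BiEdgeIn S (inj₁ _) (inj₁ _) = ⊥
BiEdgeIn S (inj₂ _) (inj₂ _) = ⊥

-- labels of the bi-clique viewed on the whole vertex set
-- (value on non-edges is irrelevant)
biLabel : ∀ {n} → (Fin n → Fin n → ℕ) → (Fin n ⊎ Fin n) → (Fin n ⊎ Fin n) → ℕ
biLabel lab (inj₁ a) (inj₂ b) = lab a b
biLabel lab (inj₂ b) (inj₁ a) = lab a b
biLabel lab (inj₁ _) (inj₁ _) = 0
biLabel lab (inj₂ _) (inj₂ _) = 0

IsBiSpanner : ∀ {n} → (Fin n → Fin n → ℕ) → List (Fin n × Fin n) → Set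
IsBiSpanner {n} lab S =
  ∀ (a b : Fin n) → Reaches (BiEdgeIn S) (biLabel lab) (inj₁ a) (inj₂ b)

BiSpannerBound : ℕ → ℕ → Set
BiSpannerBound n k = ∀ (lab : Fin n → Fin n → ℕ) →
  ∃[ S ] (IsBiSpanner lab S × length S ≤ k)

IsMinimum : (ℕ → Set) → ℕ → Set
IsMinimum P m = P m × (∀ k → P k → m ≤ k)

-- f ∈ Θ(g) (eventually, with constants; for ℕ-valued functions integer
-- constants are no loss of generality)
_∈Θ_ : (ℕ → ℕ) → (ℕ → ℕ) → Set
f ∈Θ g = ∃[ c₁ ] ∃[ c₂ ] ∃[ n₀ ] (∀ n → n₀ ≤ n → (f n ≤ c₁ * g n) × (g n ≤ c₂ * f n))

-- s(n) ≤ b(n): a bi-spanner for the labels λ(a,b) of a temporal clique, read back on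
-- the clique by identifying each a ∈ A with its copy in B, is a spanner once the
-- loops {a,a} are dropped and the walks are shortened to paths.
--
-- b(n) ≤ 6 s(n): place ⌈n/2⌉ clique vertices on A-vertices and ⌊n/2⌋ on B-vertices
-- of the bi-clique, give each A–B edge its bi-clique label plus one, the A–A edges
-- a label larger than all of these and the B–B edges label 0.  A temporal path from
-- an A-vertex to a B-vertex then can neither use a B–B edge (it starts at A with a
-- label ≥ 1) nor an A–A edge (it could never leave A again), so it is an
-- alternating walk in the bi-clique.  A spanner of this clique thus connects every
-- placed A-vertex to every placed B-vertex, and 2 × 3 shifted placements cover all
-- pairs of A × B.

module Submission where

open import Defs
open import Data.Empty using (⊥; ⊥-elim)
open import Data.Fin using (Fin; toℕ; fromℕ<) renaming (_≟_ to _≟ᶠ_)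
open import Data.Fin.Properties using (toℕ-fromℕ<; toℕ-injective; toℕ<n)
open import Data.List using (List; []; _∷_; length; filter; map; concatMap; cartesianProduct)
open import Data.List.Properties using (length-filter; length-map; length-++)
open import Data.List.Membership.Propositional using (_∈_)
open import Data.List.Membership.Propositional.Properties
  using (∈-filter⁺; ∈-map⁺; ∈-concatMap⁺; ∈-cartesianProduct⁺)
import Data.List.Membership.DecPropositional as DecMembership
open import Data.List.Relation.Binary.Subset.Propositional using (_⊆_)
open import Data.List.Relation.Unary.All.Properties using (¬Any⇒All¬; all-filter)
import Data.List.Relation.Unary.Any as Any
open import Data.List.Relation.Unary.Any using (here; there)
open import Data.List.Relation.Unary.All using ([])
open import Data.List.Relation.Unary.AllPairs using ([]; _∷_)
open import Data.List.Relation.Unary.Unique.Propositional using (Unique)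
open import Data.Nat using (ℕ; zero; suc; _≤_; _<_; _+_; _*_; _∸_; z≤n; s≤s; pred; _<?_; ⌊_/2⌋; ⌈_/2⌉)
open import Data.Nat.Properties
open import Data.Product using (Σ; _×_; _,_; ∃-syntax; proj₁; proj₂; uncurry)
open import Data.Sum using (_⊎_; inj₁; inj₂; reduce)
open import Data.Sum.Properties using (≡-dec)
open import Data.Unit using (⊤; tt)
open import Function using (_∘_; id)
open import Relation.Binary.Definitions using (DecidableEquality)
open import Relation.Binary.PropositionalEquality using (_≡_; _≢_; refl; sym; trans; cong; subst; subst₂)
open import Relation.Nullary using (yes; no; ¬?; contradiction)
open import Relation.Unary using (Decidable)

module _ {V : Set} {E : V → V → Set} {ℓ : V → V → ℕ} where

  Path : ℕ → V → V → Set
  Path t x y = Σ (Journey E ℓ t x y) (Unique ∘ verts)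

  lowerStart : ∀ {t t′ x y} → t′ ≤ t → Journey E ℓ t x y → Journey E ℓ t′ x y
  lowerStart _ here = here
  lowerStart t′≤t (step e t≤ℓ j) = step e (≤-trans t′≤t t≤ℓ) j

  step-≡ : ∀ {t s x y z} → E x y → s ≡ ℓ x y → t ≤ s → Journey E ℓ s y z → Journey E ℓ t x z
  step-≡ e refl = step e

  path-suffix : ∀ {t t′ x y z} → t′ ≤ t → (j : Journey E ℓ t y z) → Unique (verts j) →
                x ∈ verts j → Path t′ x z
  path-suffix _ here u (here refl) = here , u
  path-suffix t′≤t (step e t≤ℓ j) u (here refl) = step e (≤-trans t′≤t t≤ℓ) j , u
  path-suffix t′≤t (step e t≤ℓ j) (_ ∷ u) (there x∈j) = path-suffix (≤-trans t′≤t t≤ℓ) j u x∈j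

  -- If x recurs later on the shortened remainder, jump straight to that occurrence.
  journey⇒path : DecidableEquality V → ∀ {t x y} → Journey E ℓ t x y → Path t x y
  journey⇒path _≟_ here = here , [] ∷ []
  journey⇒path _≟_ {x = x} (step e t≤ℓ j) with journey⇒path _≟_ j
  ... | j′ , u′ with DecMembership._∈?_ _≟_ x (verts j′)
  ...   | yes x∈j′ = path-suffix t≤ℓ j′ u′ x∈j′
  ...   | no x∉j′ = step e t≤ℓ j′ , ¬Any⇒All¬ (verts j′) x∉j′ ∷ u′

mapJourney : ∀ {V W : Set} {E : V → V → Set} {F : W → W → Set} {ℓ : W → W → ℕ} (f : V → W) →
             (∀ {x y} → E x y → F (f x) (f y)) →
             ∀ {t x y} → Journey E (λ x y → ℓ (f x) (f y)) t x y → Journey F ℓ t (f x) (f y)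
mapJourney f f-edge here = here
mapJourney f f-edge (step e t≤ℓ j) = step (f-edge e) t≤ℓ (mapJourney f f-edge j)

BiEdgeIn-mono : ∀ {n} {S T : List (Fin n × Fin n)} → S ⊆ T → ∀ {x y} → BiEdgeIn S x y → BiEdgeIn T x y
BiEdgeIn-mono S⊆T {inj₁ _} {inj₂ _} e = S⊆T e
BiEdgeIn-mono S⊆T {inj₂ _} {inj₁ _} e = S⊆T e

BiWalk : ∀ {n} → (Fin n → Fin n → ℕ) → List (Fin n × Fin n) → Fin n → Fin n → Set
BiWalk lab T a b = Journey (BiEdgeIn T) (biLabel lab) 0 (inj₁ a) (inj₂ b)

ConnectsPlacement : ∀ {n} → (Fin n → Fin n → ℕ) → (Fin n → Fin n ⊎ Fin n) → List (Fin n × Fin n) → Set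
ConnectsPlacement lab φ T = ∀ {u v a b} → φ u ≡ inj₁ a → φ v ≡ inj₂ b → BiWalk lab T a b

module Collapse {n : ℕ} (L : SymLabel n) (S : List (Fin n × Fin n)) where

  lab : Fin n → Fin n → ℕ
  lab = proj₁ L

  nonLoop? : Decidable (λ (e : Fin n × Fin n) → proj₁ e ≢ proj₂ e)
  nonLoop? e = ¬? (proj₁ e ≟ᶠ proj₂ e)

  loopless : List (Fin n × Fin n)
  loopless = filter nonLoop? S

  collapse : ∀ {t x y} → Journey (BiEdgeIn S) (biLabel lab) t x y →
             Journey (EdgeIn loopless) lab t (reduce x) (reduce y)
  collapse here = here
  collapse (step {x = inj₁ a} {inj₂ b} e t≤ℓ j) with a ≟ᶠ b
  ... | yes refl = lowerStart t≤ℓ (collapse j)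
  ... | no a≢b = step (inj₁ (∈-filter⁺ nonLoop? e a≢b)) t≤ℓ (collapse j)
  collapse (step {x = inj₂ b} {inj₁ a} e t≤ℓ j) with a ≟ᶠ b
  ... | yes refl = lowerStart t≤ℓ (collapse j)
  ... | no a≢b = step-≡ (inj₂ (∈-filter⁺ nonLoop? e a≢b)) (proj₂ L a b) t≤ℓ (collapse j)

biSpannerBound⇒spannerBound : ∀ {n k} → BiSpannerBound n k → SpannerBound n k
biSpannerBound⇒spannerBound H L with H (proj₁ L)
... | S , isBiSpanner , |S|≤k =
  loopless , (all-filter nonLoop? S , reach) , ≤-trans (length-filter nonLoop? S) |S|≤k
  where
  open Collapse L S
  reach : ∀ u v → u ≢ v → Reaches (EdgeIn loopless) lab u v
  reach u v _ = journey⇒path _≟ᶠ_ (collapse (proj₁ (isBiSpanner u v)))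

sumFin : ∀ {n} → (Fin n → ℕ) → ℕ
sumFin {zero} f = 0
sumFin {suc n} f = f Fin.zero + sumFin (f ∘ Fin.suc)

≤-sumFin : ∀ {n} (f : Fin n → ℕ) i → f i ≤ sumFin f
≤-sumFin f Fin.zero = m≤m+n _ _
≤-sumFin f (Fin.suc i) = ≤-trans (≤-sumFin (f ∘ Fin.suc) i) (m≤n+m _ _)

module Block {n : ℕ} (lab : Fin n → Fin n → ℕ) where

  W : Set
  W = Fin n ⊎ Fin n

  top : ℕ
  top = suc (suc (sumFin (sumFin ∘ lab)))

  suc-lab<top : ∀ a b → suc (lab a b) < top
  suc-lab<top a b = s≤s (s≤s (≤-trans (≤-sumFin (lab a) b) (≤-sumFin (sumFin ∘ lab) a)))

  blockLabel : W → W → ℕ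
  blockLabel (inj₁ _) (inj₁ _) = top
  blockLabel (inj₂ _) (inj₂ _) = 0
  blockLabel (inj₁ a) (inj₂ b) = suc (lab a b)
  blockLabel (inj₂ b) (inj₁ a) = suc (lab a b)

  blockLabel-sym : ∀ p q → blockLabel p q ≡ blockLabel q p
  blockLabel-sym (inj₁ _) (inj₁ _) = refl
  blockLabel-sym (inj₁ _) (inj₂ _) = refl
  blockLabel-sym (inj₂ _) (inj₁ _) = refl
  blockLabel-sym (inj₂ _) (inj₂ _) = refl

  -- Only A–B pairs ever matter; the others get an arbitrary value.
  biEdge : W → W → Fin n × Fin n
  biEdge (inj₁ a) (inj₂ b) = a , b
  biEdge (inj₂ b) (inj₁ a) = a , b
  biEdge (inj₁ a) (inj₁ a′) = a , a′
  biEdge (inj₂ b) (inj₂ b′) = b , b′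

  BlockEdge : List (Fin n × Fin n) → W → W → Set
  BlockEdge T p q = (biEdge p q ∈ T) ⊎ (biEdge q p ∈ T)

  module _ {T : List (Fin n × Fin n)} where

    trappedInA : ∀ {t a b} → Journey (BlockEdge T) blockLabel t (inj₁ a) (inj₂ b) → top ≤ t → ⊥
    trappedInA (step {y = inj₁ _} e t≤ℓ j) _ = trappedInA j ≤-refl
    trappedInA (step {x = inj₁ a} {inj₂ b} e t≤ℓ j) top≤t = <⇒≱ (suc-lab<top a b) (≤-trans top≤t t≤ℓ)

    CanStart : W → ℕ → Set
    CanStart (inj₁ _) t = ⊤
    CanStart (inj₂ _) t = 1 ≤ t

    toBiJourney : ∀ {t p b} → Journey (BlockEdge T) blockLabel t p (inj₂ b) → CanStart p t →
                  Journey (BiEdgeIn T) (biLabel lab) (pred t) p (inj₂ b)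
    toBiJourney here _ = here
    toBiJourney (step {x = inj₁ _} {inj₁ _} e t≤ℓ j) _ = ⊥-elim (trappedInA j ≤-refl)
    toBiJourney (step {x = inj₁ _} {inj₂ _} e t≤ℓ j) _ = step (reduce e) (pred-mono-≤ t≤ℓ) (toBiJourney j (s≤s z≤n))
    toBiJourney (step {x = inj₂ _} {inj₁ _} e t≤ℓ j) _ = step (reduce e) (pred-mono-≤ t≤ℓ) (toBiJourney j tt)
    toBiJourney (step {x = inj₂ _} {inj₂ _} e t≤ℓ j) 1≤t = contradiction (≤-trans 1≤t t≤ℓ) λ ()

  spannerBound⇒connectsPlacement : ∀ {k} → SpannerBound n k → (φ : Fin n → W) →
                                   ∃[ T ] (length T ≤ k × ConnectsPlacement lab φ T)
  spannerBound⇒connectsPlacement {k} H φ with H ((λ x y → blockLabel (φ x) (φ y)) , λ x y → blockLabel-sym (φ x) (φ y))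
  ... | S , (_ , reach) , |S|≤k = T , subst (_≤ k) (sym (length-map image S)) |S|≤k , walk
    where
    image : Fin n × Fin n → Fin n × Fin n
    image (x , y) = biEdge (φ x) (φ y)
    T : List (Fin n × Fin n)
    T = map image S
    imageEdge : ∀ {x y} → EdgeIn S x y → BlockEdge T (φ x) (φ y)
    imageEdge (inj₁ xy∈S) = inj₁ (∈-map⁺ image xy∈S)
    imageEdge (inj₂ yx∈S) = inj₂ (∈-map⁺ image yx∈S)
    walk : ConnectsPlacement lab φ T
    walk {u} {v} φu≡a φv≡b = toBiJourney (subst₂ (Journey (BlockEdge T) blockLabel 0) φu≡a φv≡b
      (mapJourney φ imageEdge (proj₁ (reach u v u≢v)))) tt
      where u≢v : u ≢ v
            u≢v refl with trans (sym φu≡a) φv≡b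
            ... | ()

length-concatMap≤ : ∀ {A B : Set} {k} (f : A → List B) → (∀ x → length (f x) ≤ k) →
                    ∀ xs → length (concatMap f xs) ≤ length xs * k
length-concatMap≤ f |f|≤k [] = z≤n
length-concatMap≤ f |f|≤k (x ∷ xs) =
  subst (_≤ _) (sym (length-++ (f x))) (+-mono-≤ (|f|≤k x) (length-concatMap≤ f |f|≤k xs))

⊆-concatMap : ∀ {A B : Set} (f : A → List B) {x xs} → x ∈ xs → f x ⊆ concatMap f xs
⊆-concatMap f x∈xs y∈fx = ∈-concatMap⁺ f (Any.map (λ { refl → y∈fx }) x∈xs)

clamp : ∀ {n} → Fin n → ℕ → Fin n
clamp {n} i k with k <? n
... | yes k<n = fromℕ< k<n
... | no _ = i

toℕ-clamp : ∀ {n} (i : Fin n) {k} → k < n → toℕ (clamp i k) ≡ k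
toℕ-clamp {n} i {k} k<n with k <? n
... | yes k<n′ = toℕ-fromℕ< k<n′
... | no k≮n = contradiction k<n k≮n

module Placement {n : ℕ} (h : ℕ) where

  shift : ℕ → ℕ → Fin n → Fin n
  shift o c i = clamp i (c + (toℕ i ∸ o))

  shift-onto : ∀ {o w c} (a : Fin n) → o + w ≤ n → c ≤ toℕ a → toℕ a < c + w →
               ∃[ i ] (o ≤ toℕ i × toℕ i < o + w × shift o c i ≡ a)
  shift-onto {o} {w} {c} a o+w≤n c≤a a<c+w =
    i , subst (o ≤_) (sym toℕ-i) (m≤m+n o x) , subst (_< o + w) (sym toℕ-i) o+x<o+w ,
    toℕ-injective (trans (toℕ-clamp i (subst (_< n) (sym c+[i∸o]≡a) (toℕ<n a))) c+[i∸o]≡a)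
    where
    x : ℕ
    x = toℕ a ∸ c
    o+x<o+w : o + x < o + w
    o+x<o+w = +-monoʳ-< o (subst (x <_) (m+n∸m≡n c w) (∸-monoˡ-< a<c+w c≤a))
    i : Fin n
    i = fromℕ< (<-≤-trans o+x<o+w o+w≤n)
    toℕ-i : toℕ i ≡ o + x
    toℕ-i = toℕ-fromℕ< _
    c+[i∸o]≡a : c + (toℕ i ∸ o) ≡ toℕ a
    c+[i∸o]≡a = trans (cong (λ z → c + (z ∸ o)) toℕ-i) (trans (cong (c +_) (m+n∸m≡n o x)) (m+[n∸m]≡n c≤a))

  place : ℕ → ℕ → Fin n → Fin n ⊎ Fin n
  place c d i with toℕ i <? h
  ... | yes _ = inj₁ (shift 0 c i)
  ... | no _ = inj₂ (shift h d i)

  place-onto-A : ∀ {c} d (a : Fin n) → h ≤ n → c ≤ toℕ a → toℕ a < c + h → ∃[ u ] place c d u ≡ inj₁ a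
  place-onto-A {c} d a h≤n c≤a a<c+h with shift-onto {0} a h≤n c≤a a<c+h
  ... | u , _ , u<h , shift≡a = u , trans placed (cong inj₁ shift≡a)
    where
    placed : place c d u ≡ inj₁ (shift 0 c u)
    placed with toℕ u <? h
    ... | yes _ = refl
    ... | no u≮h = contradiction u<h u≮h

  place-onto-B : ∀ c {d m} (b : Fin n) → h + m ≤ n → d ≤ toℕ b → toℕ b < d + m → ∃[ v ] place c d v ≡ inj₂ b
  place-onto-B c {d} b h+m≤n d≤b b<d+m with shift-onto {h} b h+m≤n d≤b b<d+m
  ... | v , h≤v , _ , shift≡b = v , trans placed (cong inj₂ shift≡b)
    where
    placed : place c d v ≡ inj₂ (shift h d v)
    placed with toℕ v <? h
    ... | yes v<h = contradiction v<h (≤⇒≯ h≤v)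
    ... | no _ = refl

offsetA : ∀ {h m x} → m ≤ h → x < h + m → ∃[ c ] (c ∈ 0 ∷ m ∷ [] × c ≤ x × x < c + h)
offsetA {h} {m} {x} m≤h x<h+m with x <? h
... | yes x<h = 0 , here refl , z≤n , x<h
... | no x≮h = m , there (here refl) , ≤-trans m≤h (≮⇒≥ x≮h) , subst (x <_) (+-comm h m) x<h+m

offsetB : ∀ {h m x} → h ≤ m + m → x < h + m → ∃[ d ] (d ∈ 0 ∷ m ∷ h ∷ [] × d ≤ x × x < d + m)
offsetB {h} {m} {x} h≤2m x<h+m with x <? m
... | yes x<m = 0 , here refl , z≤n , x<m
... | no x≮m with x <? m + m
...   | yes x<2m = m , there (here refl) , ≮⇒≥ x≮m , x<2m
...   | no x≮2m = h , there (there (here refl)) , ≤-trans h≤2m (≮⇒≥ x≮2m) , x<h+m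

⌈n/2⌉≤1+⌊n/2⌋ : ∀ n → ⌈ n /2⌉ ≤ suc ⌊ n /2⌋
⌈n/2⌉≤1+⌊n/2⌋ zero = z≤n
⌈n/2⌉≤1+⌊n/2⌋ (suc zero) = ≤-refl
⌈n/2⌉≤1+⌊n/2⌋ (suc (suc n)) = s≤s (⌈n/2⌉≤1+⌊n/2⌋ n)

⌈n/2⌉≤⌊n/2⌋+⌊n/2⌋ : ∀ n → 2 ≤ n → ⌈ n /2⌉ ≤ ⌊ n /2⌋ + ⌊ n /2⌋
⌈n/2⌉≤⌊n/2⌋+⌊n/2⌋ n (s≤s (s≤s _)) = ≤-trans (⌈n/2⌉≤1+⌊n/2⌋ n) (+-monoˡ-≤ ⌊ n /2⌋ (s≤s z≤n))

spannerBound⇒biSpannerBound : ∀ {n k} → 2 ≤ n → SpannerBound n k → BiSpannerBound n (6 * k)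
spannerBound⇒biSpannerBound {n} {k} 2≤n H lab =
  T , (λ a b → journey⇒path (≡-dec _≟ᶠ_ _≟ᶠ_) (walk a b)) ,
  length-concatMap≤ (proj₁ ∘ block) (proj₁ ∘ proj₂ ∘ block) offsets
  where
  open Block lab using (spannerBound⇒connectsPlacement)
  h m : ℕ
  h = ⌈ n /2⌉
  m = ⌊ n /2⌋
  open Placement {n} h
  n≡h+m : n ≡ h + m
  n≡h+m = trans (sym (⌊n/2⌋+⌈n/2⌉≡n n)) (+-comm m h)
  index< : (a : Fin n) → toℕ a < h + m
  index< a = subst (toℕ a <_) n≡h+m (toℕ<n a)
  offsets : List (ℕ × ℕ)
  offsets = cartesianProduct (0 ∷ m ∷ []) (0 ∷ m ∷ h ∷ [])
  block : (cd : ℕ × ℕ) → ∃[ T ] (length T ≤ k × ConnectsPlacement lab (uncurry place cd) T)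
  block (c , d) = spannerBound⇒connectsPlacement H (place c d)
  T : List (Fin n × Fin n)
  T = concatMap (proj₁ ∘ block) offsets
  walk : ∀ a b → BiWalk lab T a b
  walk a b with offsetA (⌊n/2⌋≤⌈n/2⌉ n) (index< a) | offsetB (⌈n/2⌉≤⌊n/2⌋+⌊n/2⌋ n 2≤n) (index< b)
  ... | c , c∈ , c≤a , a<c+h | d , d∈ , d≤b , b<d+m
    with place-onto-A d a (subst (h ≤_) (sym n≡h+m) (m≤m+n h m)) c≤a a<c+h
       | place-onto-B c b (subst (h + m ≤_) (sym n≡h+m) ≤-refl) d≤b b<d+m
  ... | u , u↦a | v , v↦b = mapJourney id
    (BiEdgeIn-mono (⊆-concatMap (proj₁ ∘ block) (∈-cartesianProduct⁺ c∈ d∈)))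
    (proj₂ (proj₂ (block (c , d))) u↦a v↦b)

theorem3 : (s b : ℕ → ℕ) →
    (∀ n → IsMinimum (SpannerBound n) (s n)) →
    (∀ n → IsMinimum (BiSpannerBound n) (b n)) →
    s ∈Θ b
theorem3 s b s-min b-min = 1 , 6 , 2 , λ n 2≤n →
  subst (s n ≤_) (sym (*-identityˡ (b n)))
    (proj₂ (s-min n) (b n) (biSpannerBound⇒spannerBound (proj₁ (b-min n)))) ,
  proj₂ (b-min n) (6 * s n) (spannerBound⇒biSpannerBound 2≤n (proj₁ (s-min n)))
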